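{- Let $\mathbf{g}$ be a generalized Golay--Shapiro sequence. Then (a) for all $n \geq 15$, $r_{\mathbf{g}}(n) = \rho_{\mathbf{g}} (n) = 8n-8$; and (b) the reflection complexity is the same for every generalized Golay--Shapiro sequence, with $(r_{\mathbf{g}}(n))_{1\le n\le 14} = 2, 3, 6, 10, 14, 22, 30, 42, 48, 62, 72, 83, 92, 103$.
   Context: Let $E$ be the morphism on $\{0,1\}^*$ exchanging $0$ and $1$, and for $u=u(1)\cdots u(m)$ let $u^R=u(m)\cdots u(1)$. Given an infinite sequence $\mathbf{f}=f_0f_1\cdots$ of binary unfolding instructions, define $p_{\varepsilon}=\varepsilon$ and $p_{f_0\cdots f_{i+1}} = p_{f_0\cdots f_i}\, f_{i+1}\, E(p_{f_0\cdots f_i}^R)$; the limit is the paperfolding sequence $\mathbf{p}_{\mathbf{f}}$. A generalized Golay--Shapiro sequence is the running sum, modulo $2$, of a paperfolding sequence $\mathbf{p}_{\mathbf{f}}$. A factor is a finite contiguous block. $\rho_{\mathbf{g}}(n)$ is the number of distinct length-$n$ factors; $r_{\mathbf{g}}(n)$ the number of distinct length-$n$ factors up to $u\sim v\iff v\in\{u,u^R\}$. -}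

module Defs where

open import Data.Bool using (Bool; true; false; not; _xor_)
open import Data.Nat using (ℕ; zero; suc; _+_; _*_; _∸_; _≤_)
open import Data.List using (List; []; _∷_; _++_; [_]; map; reverse; length; upTo)
open import Data.List.Membership.Propositional using (_∈_)
open import Data.List.Relation.Unary.All using (All)
open import Data.List.Relation.Unary.Any using (Any)
open import Data.List.Relation.Unary.Unique.Propositional using (Unique)
open import Data.List.Relation.Unary.AllPairs using (AllPairs)
open import Data.Product using (Σ; ∃; _×_)
open import Data.Sum using (_⊎_)
open import Relation.Binary.PropositionalEquality using (_≡_)
open import Relation.Nullary using (¬_)

Word : Set
Word = List Bool

-- E : exchange 0 and 1 (Bool: false = 0, true = 1)
E : Word → Word
E = map not

-- pfold f k = p_{f_0 ⋯ f_{k-1}}  (pfold f 0 = p_ε = ε)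
pfold : (ℕ → Bool) → ℕ → Word
pfold f zero    = []
pfold f (suc k) = pfold f k ++ [ f k ] ++ E (reverse (pfold f k))

-- m-th letter of a word (0-indexed), default false if out of range
nth : Word → ℕ → Bool
nth []       _       = false
nth (x ∷ _)  zero    = x
nth (_ ∷ xs) (suc m) = nth xs m

-- the limit paperfolding sequence: pfold f (suc m) has length 2^(m+1)-1 > m,
-- and each pfold f k is a prefix of pfold f (suc k)
paperfolding : (ℕ → Bool) → ℕ → Bool
paperfolding f m = nth (pfold f (suc m)) m

runningSum : (ℕ → Bool) → ℕ → Bool
runningSum p zero    = false
runningSum p (suc n) = runningSum p n xor p n

golayShapiro : (ℕ → Bool) → ℕ → Bool
golayShapiro f = runningSum (paperfolding f)

factorAt : (ℕ → Bool) → ℕ → ℕ → Word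
factorAt g i n = map (λ j → g (i + j)) (upTo n)

IsFactor : (ℕ → Bool) → ℕ → Word → Set
IsFactor g n w = ∃ λ i → factorAt g i n ≡ w

_∼_ : Word → Word → Set
u ∼ v = (v ≡ u) ⊎ (v ≡ reverse u)

FactorComplexity : (ℕ → Bool) → ℕ → ℕ → Set
FactorComplexity g n k =
  Σ (List Word) λ L →
    length L ≡ k × Unique L × All (IsFactor g n) L × (∀ i → factorAt g i n ∈ L)

ReflectionComplexity : (ℕ → Bool) → ℕ → ℕ → Set
ReflectionComplexity g n k =
  Σ (List Word) λ L →
    length L ≡ k × AllPairs (λ u v → ¬ (u ∼ v)) L × All (IsFactor g n) L
    × (∀ i → Any (λ u → u ∼ factorAt g i n) L)

rTable : ℕ → ℕ
rTable 1  = 2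
rTable 2  = 3
rTable 3  = 6
rTable 4  = 10
rTable 5  = 14
rTable 6  = 22
rTable 7  = 30
rTable 8  = 42
rTable 9  = 48
rTable 10 = 62
rTable 11 = 72
rTable 12 = 83
rTable 13 = 92
rTable 14 = 103
rTable _  = 0

-- Writing p′ for the paperfolding sequence of the shifted instructions f ∘ suc, one has p(2t) = f₀ + t and
-- p(2t + 1) = p′(t) (mod 2).  Hence the length-n factors of p, tagged with the parity of an occurrence, are built
-- from those of p′ of lengths ⌊n/2⌋ and ⌈n/2⌉: there are 4n of them, and for n ≥ 7 the tag is determined by the
-- factor, because the even positions of p alternate while p′ has no factor of length 4 and period 2.
-- A factor of g of length n + 1 is a first letter followed by the running sums of a length-n factor of p, and every
-- factor of p occurs behind both first letters: a shift by a suitable multiple D of a large power of two preserves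
-- p on the window, and g(D) = 1 for one of D = 2^(J+2)·q, q = 1, 2, 3.  So ρ(n + 1) = 8n.  When n + 1 ≥ 15 no
-- factor of g is the reversal of another, since a reversed pair would force such a period-2 pattern into p or p′;
-- hence r = ρ.  For n ≤ 14 the classes are counted by computation.
module Submission where

open import Defs
open import Data.Bool using (Bool; true; false; not; _xor_; _≟_)
open import Data.Bool.Properties
  using (¬-not; not-¬; not-involutive; not-injective; not-distribˡ-xor; not-distribʳ-xor;
         xor-identityʳ; xor-assoc; xor-comm; xor-inverseʳ; xor-same)
open import Data.Nat using (ℕ; zero; suc; _+_; _*_; _∸_; _^_; _≤_; _<_; z≤n; s≤s; s≤s⁻¹; ⌊_/2⌋; ⌈_/2⌉)
open import Data.Nat.Properties
  using (+-comm; +-assoc; +-suc; +-identityʳ; suc-injective; *-assoc; *-identityʳ; *-suc; *-distribˡ-+;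
         ≤-trans; ≤-refl; ≤-reflexive; <-≤-trans; ≤-<-trans; m≤m+n; m≤n+m; n≤1+n; n<1+n; m<n⇒m<1+n;
         ^-monoʳ-≤; ^-monoʳ-<; ⌊n/2⌋≤n; ⌈n/2⌉≤n; ⌊n/2⌋+⌈n/2⌉≡n; m+[n∸m]≡n; m+n∸m≡n)
import Data.Nat.Properties as ℕₚ
open import Data.Product using (∃; _×_; _,_; proj₁; proj₂)
open import Data.Sum using (_⊎_; inj₁; inj₂)
open import Data.List
  using (List; []; _∷_; _++_; [_]; map; reverse; length; upTo; applyUpTo; scanl; cartesianProductWith; deduplicate)
open import Data.List.Properties
  using (∷-injective; length-++; length-map; length-reverse; unfold-reverse; reverse-++; reverse-involutive;
         ++-identityʳ; ≡-dec)
open import Data.List.Membership.Propositional using (_∈_)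
open import Data.List.Membership.Propositional.Properties
  using (∈-map⁺; ∈-map⁻; ∈-++⁺ˡ; ∈-++⁺ʳ; ∈-cartesianProductWith⁺; ∈-cartesianProductWith⁻; ∈-upTo⁺)
open import Data.List.Relation.Unary.Any as Any using (here; there)
import Data.List.Relation.Unary.Any.Properties as Any
open import Data.List.Relation.Unary.All as All using (All; []; _∷_)
import Data.List.Relation.Unary.All.Properties as All
open import Data.List.Relation.Unary.AllPairs using (AllPairs; []; _∷_)
import Data.List.Relation.Unary.AllPairs.Properties as AllPairs
open import Data.List.Relation.Unary.Unique.Propositional using (Unique)
import Data.List.Relation.Unary.Unique.Propositional.Properties as Unique
open import Data.List.Relation.Unary.Unique.DecSetoid.Properties using (deduplicate-!)
open import Function using (_∘_)
open import Relation.Binary.Bundles using (DecSetoid)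
open import Relation.Binary.Definitions using (Decidable)
open import Relation.Binary.PropositionalEquality hiding ([_])
open import Relation.Nullary using (¬_; Dec; yes; no; contradiction)
open import Relation.Nullary.Decidable using (map′; _×-dec_; _⊎-dec_; from-yes)
open ≡-Reasoning

variable
  A : Set

shift : (ℕ → A) → ℕ → A
shift x k = x (suc k)

double : ℕ → ℕ
double zero    = zero
double (suc n) = suc (suc (double n))

isOdd : ℕ → Bool
isOdd zero    = false
isOdd (suc n) = not (isOdd n)

data EvenOdd : ℕ → Set where
  even : ∀ t → EvenOdd (double t)
  odd  : ∀ t → EvenOdd (suc (double t))

evenOdd : ∀ n → EvenOdd n
evenOdd zero = even zero
evenOdd (suc n) with evenOdd n
... | even t = odd t
... | odd t  = even (suc t)

double≡+ : ∀ n → double n ≡ n + n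
double≡+ zero    = refl
double≡+ (suc n) = cong suc (trans (cong suc (double≡+ n)) (sym (+-suc n n)))

double-+ : ∀ m n → double (m + n) ≡ double m + double n
double-+ zero    n = refl
double-+ (suc m) n = cong (suc ∘ suc) (double-+ m n)

n≤double : ∀ n → n ≤ double n
n≤double n = subst (n ≤_) (sym (double≡+ n)) (m≤m+n n n)

double-<-cancel : ∀ {a b} → double a < double b → a < b
double-<-cancel {zero}  {suc b} _               = s≤s z≤n
double-<-cancel {suc a} {suc b} (s≤s (s≤s a<b)) = s≤s (double-<-cancel a<b)

2^suc*≡double : ∀ J q → 2 ^ suc J * q ≡ double (2 ^ J * q)
2^suc*≡double J q = begin
  2 ^ suc J * q         ≡⟨ *-assoc 2 (2 ^ J) q ⟩
  2 * (2 ^ J * q)       ≡⟨ cong (2 ^ J * q +_) (+-identityʳ (2 ^ J * q)) ⟩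
  2 ^ J * q + 2 ^ J * q ≡⟨ double≡+ (2 ^ J * q) ⟨
  double (2 ^ J * q)    ∎

n<2^n : ∀ n → n < 2 ^ n
n<2^n zero    = s≤s z≤n
n<2^n (suc n) = ≤-<-trans (n<2^n n) (^-monoʳ-< 2 (s≤s (s≤s z≤n)) (n<1+n n))

isOdd-+ : ∀ m n → isOdd (m + n) ≡ isOdd m xor isOdd n
isOdd-+ zero    n = refl
isOdd-+ (suc m) n = trans (cong not (isOdd-+ m n)) (not-distribˡ-xor (isOdd m) (isOdd n))

isOdd-double : ∀ n → isOdd (double n) ≡ false
isOdd-double zero    = refl
isOdd-double (suc n) = trans (not-involutive _) (isOdd-double n)

isOdd-double-+ : ∀ a t → isOdd (double a + t) ≡ isOdd t
isOdd-double-+ a t = trans (isOdd-+ (double a) t) (cong (_xor isOdd t) (isOdd-double a))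

not-xor-comm : ∀ b c → not b xor c ≡ b xor not c
not-xor-comm b c = trans (sym (not-distribˡ-xor b c)) (not-distribʳ-xor b c)

xor-cancelˡ : ∀ b {c d} → b xor c ≡ b xor d → c ≡ d
xor-cancelˡ false eq = eq
xor-cancelˡ true  eq = not-injective eq

xor-interchange : ∀ a b c d → ((a xor b) xor c) xor d ≡ (a xor d) xor (b xor c)
xor-interchange a b c d = begin
  ((a xor b) xor c) xor d ≡⟨ cong (_xor d) (xor-assoc a b c) ⟩
  (a xor (b xor c)) xor d ≡⟨ xor-assoc a (b xor c) d ⟩
  a xor ((b xor c) xor d) ≡⟨ cong (a xor_) (xor-comm (b xor c) d) ⟩
  a xor (d xor (b xor c)) ≡⟨ xor-assoc a d (b xor c) ⟨
  (a xor d) xor (b xor c) ∎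

xor³≡true : ∀ {a b c} → (a xor b) xor c ≡ true → a ≡ true ⊎ b ≡ true ⊎ c ≡ true
xor³≡true {true}                _  = inj₁ refl
xor³≡true {false} {true}        _  = inj₂ (inj₁ refl)
xor³≡true {false} {false} {true} _ = inj₂ (inj₂ refl)

alternatingFrom : Bool → ℕ → Bool
alternatingFrom b s = b xor isOdd s

alternatingFrom-double-+ : ∀ b k n → alternatingFrom b (double k + n) ≡ alternatingFrom b n
alternatingFrom-double-+ b k n = cong (b xor_) (isOdd-double-+ k n)

alternatingFrom-≢-suc : ∀ b n → alternatingFrom b n ≢ alternatingFrom b (suc n)
alternatingFrom-≢-suc b n eq = not-¬ refl (xor-cancelˡ b eq)

all-Bool? : ∀ {P : Bool → Set} → (∀ b → Dec (P b)) → Dec (∀ b → P b)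
all-Bool? P? =
  map′ (λ (p₀ , p₁) → λ { false → p₀ ; true → p₁ }) (λ ∀P → ∀P false , ∀P true) (P? false ×-dec P? true)

infixr 5 _∷ˢ_
_∷ˢ_ : A → (ℕ → A) → ℕ → A
(a ∷ˢ x) zero    = a
(a ∷ˢ x) (suc k) = x k

prefix4 : (ℕ → A) → ℕ → A
prefix4 f = f 0 ∷ˢ f 1 ∷ˢ f 2 ∷ˢ f 3 ∷ˢ λ k → f (4 + k)

≗prefix4 : (f : ℕ → A) → f ≗ prefix4 f
≗prefix4 f 0                         = refl
≗prefix4 f 1                         = refl
≗prefix4 f 2                         = refl
≗prefix4 f 3                         = refl
≗prefix4 f (suc (suc (suc (suc k)))) = refl

interleave : List A → List A → List A
interleave []       ys = ys
interleave (x ∷ xs) ys = x ∷ interleave ys xs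

interleave-++ : ∀ (xs ys us vs : List A) → length xs ≡ length ys →
  interleave xs ys ++ interleave us vs ≡ interleave (xs ++ us) (ys ++ vs)
interleave-++ˡ : ∀ (xs ys us vs : List A) → length xs ≡ suc (length ys) →
  interleave xs ys ++ interleave us vs ≡ interleave (xs ++ vs) (ys ++ us)
interleave-++ []       []       us vs _  = refl
interleave-++ (x ∷ xs) (y ∷ ys) us vs eq = cong (x ∷_) (interleave-++ˡ (y ∷ ys) xs us vs (sym eq))
interleave-++ˡ (x ∷ xs) ys us vs eq = cong (x ∷_) (interleave-++ ys xs us vs (sym (suc-injective eq)))

reverse-interleave : ∀ (xs ys : List A) → length xs ≡ length ys →
  reverse (interleave xs ys) ≡ interleave (reverse ys) (reverse xs)
reverse-interleaveˡ : ∀ (xs ys : List A) → length xs ≡ suc (length ys) →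
  reverse (interleave xs ys) ≡ interleave (reverse xs) (reverse ys)
reverse-interleave [] [] _ = refl
reverse-interleave (x ∷ xs) (y ∷ ys) eq = begin
  reverse (x ∷ interleave (y ∷ ys) xs)
    ≡⟨ unfold-reverse x (interleave (y ∷ ys) xs) ⟩
  reverse (interleave (y ∷ ys) xs) ++ [ x ]
    ≡⟨ cong (_++ [ x ]) (reverse-interleaveˡ (y ∷ ys) xs (sym eq)) ⟩
  interleave (reverse (y ∷ ys)) (reverse xs) ++ interleave [ x ] []
    ≡⟨ interleave-++ˡ (reverse (y ∷ ys)) (reverse xs) [ x ] [] lengths ⟩
  interleave (reverse (y ∷ ys) ++ []) (reverse xs ++ [ x ])
    ≡⟨ cong₂ interleave (++-identityʳ _) (sym (unfold-reverse x xs)) ⟩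
  interleave (reverse (y ∷ ys)) (reverse (x ∷ xs)) ∎
  where
  lengths : length (reverse (y ∷ ys)) ≡ suc (length (reverse xs))
  lengths = trans (length-reverse (y ∷ ys)) (trans (sym eq) (cong suc (sym (length-reverse xs))))
reverse-interleaveˡ (x ∷ xs) ys eq = begin
  reverse (x ∷ interleave ys xs)
    ≡⟨ unfold-reverse x (interleave ys xs) ⟩
  reverse (interleave ys xs) ++ [ x ]
    ≡⟨ cong (_++ [ x ]) (reverse-interleave ys xs (sym (suc-injective eq))) ⟩
  interleave (reverse xs) (reverse ys) ++ interleave [ x ] []
    ≡⟨ interleave-++ (reverse xs) (reverse ys) [ x ] [] lengths ⟩
  interleave (reverse xs ++ [ x ]) (reverse ys ++ [])
    ≡⟨ cong₂ interleave (sym (unfold-reverse x xs)) (++-identityʳ _) ⟩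
  interleave (reverse (x ∷ xs)) (reverse ys) ∎
  where
  lengths : length (reverse xs) ≡ length (reverse ys)
  lengths = trans (length-reverse xs) (trans (suc-injective eq) (sym (length-reverse ys)))

map-interleave : ∀ {B : Set} (g : A → B) xs ys → map g (interleave xs ys) ≡ interleave (map g xs) (map g ys)
map-interleave g []       ys = refl
map-interleave g (x ∷ xs) ys = cong (g x ∷_) (map-interleave g ys xs)

interleave-injective : ∀ (xs ys us vs : List A) → length xs ≡ length ys → length us ≡ length vs →
  interleave xs us ≡ interleave ys vs → xs ≡ ys × us ≡ vs
interleave-injective []       []       us vs _  _  eq = refl , eq
interleave-injective (x ∷ xs) (y ∷ ys) us vs lx lu eq with ∷-injective eq
... | refl , eq′ with interleave-injective us vs xs ys lu (suc-injective lx) eq′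
...   | refl , refl = refl , refl

alternating : Bool → ℕ → Word
alternating b zero    = []
alternating b (suc n) = b ∷ alternating (not b) n

length-alternating : ∀ b n → length (alternating b n) ≡ n
length-alternating b zero    = refl
length-alternating b (suc n) = cong suc (length-alternating (not b) n)

length-alternating-indep : ∀ b c n → length (alternating b n) ≡ length (alternating c n)
length-alternating-indep b c n = trans (length-alternating b n) (sym (length-alternating c n))

alternating-snoc : ∀ b n → alternating b (suc n) ≡ alternating b n ++ [ b xor isOdd n ]
alternating-snoc b zero    = cong [_] (sym (xor-identityʳ b))
alternating-snoc b (suc n) = cong (b ∷_) (begin
  alternating (not b) (suc n)                    ≡⟨ alternating-snoc (not b) n ⟩
  alternating (not b) n ++ [ not b xor isOdd n ] ≡⟨ cong (λ c → alternating (not b) n ++ [ c ]) (not-xor-comm b (isOdd n)) ⟩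
  alternating (not b) n ++ [ b xor isOdd (suc n) ] ∎)

alternating-++ : ∀ b m n → alternating b m ++ alternating (b xor isOdd m) n ≡ alternating b (m + n)
alternating-++ b zero    n = cong (λ c → alternating c n) (xor-identityʳ b)
alternating-++ b (suc m) n = cong (b ∷_) (begin
  alternating (not b) m ++ alternating (b xor not (isOdd m)) n
    ≡⟨ cong (λ c → alternating (not b) m ++ alternating c n) (sym (not-xor-comm b (isOdd m))) ⟩
  alternating (not b) m ++ alternating (not b xor isOdd m) n
    ≡⟨ alternating-++ (not b) m n ⟩
  alternating (not b) (m + n) ∎)

E-reverse-alternating : ∀ b n → E (reverse (alternating b n)) ≡ alternating (b xor isOdd n) n
E-reverse-alternating b zero    = refl
E-reverse-alternating b (suc n) = begin
  E (reverse (alternating b (suc n)))        ≡⟨ cong (E ∘ reverse) (alternating-snoc b n) ⟩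
  E (reverse (alternating b n ++ [ c ]))     ≡⟨ cong E (reverse-++ (alternating b n) [ c ]) ⟩
  not c ∷ E (reverse (alternating b n))      ≡⟨ cong (not c ∷_) (E-reverse-alternating b n) ⟩
  not c ∷ alternating c n                    ≡⟨ cong (λ d → not c ∷ alternating d n) (sym (not-involutive c)) ⟩
  alternating (not c) (suc n)                ≡⟨ cong (λ d → alternating d (suc n)) (not-distribʳ-xor b (isOdd n)) ⟩
  alternating (b xor isOdd (suc n)) (suc n)  ∎
  where
  c : Bool
  c = b xor isOdd n

nth-++ˡ : ∀ (xs ys : Word) {m} → m < length xs → nth (xs ++ ys) m ≡ nth xs m
nth-++ˡ (x ∷ xs) ys {zero}  _         = refl
nth-++ˡ (x ∷ xs) ys {suc m} (s≤s m<n) = nth-++ˡ xs ys m<n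

nth-interleave-even : ∀ (xs ys : Word) {t} → t < length xs → length xs ≤ suc (length ys) →
  nth (interleave xs ys) (double t) ≡ nth xs t
nth-interleave-odd : ∀ (xs ys : Word) {t} → t < length ys → length ys ≤ length xs →
  nth (interleave xs ys) (suc (double t)) ≡ nth ys t
nth-interleave-even (x ∷ xs) ys {zero}  _         _          = refl
nth-interleave-even (x ∷ xs) ys {suc t} (s≤s t<n) (s≤s n≤m) = nth-interleave-odd ys xs t<n n≤m
nth-interleave-odd (x ∷ xs) (y ∷ ys) t<n (s≤s n≤m) = nth-interleave-even (y ∷ ys) xs t<n (s≤s n≤m)

nth-alternating : ∀ b {n t} → t < n → nth (alternating b n) t ≡ b xor isOdd t
nth-alternating b {suc n} {zero}  _         = sym (xor-identityʳ b)
nth-alternating b {suc n} {suc t} (s≤s t<n) = trans (nth-alternating (not b) t<n) (not-xor-comm b (isOdd t))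

scanl-injective : ∀ {B : Set} (_∙_ : A → B → A) → (∀ a {b b′} → a ∙ b ≡ a ∙ b′ → b ≡ b′) →
  ∀ {a a′ bs bs′} → scanl _∙_ a bs ≡ scanl _∙_ a′ bs′ → a ≡ a′ × bs ≡ bs′
scanl-injective _∙_ ∙-inj {bs = []}         {[]}          refl = refl , refl
scanl-injective _∙_ ∙-inj {bs = []}         {_ ∷ []}      ()
scanl-injective _∙_ ∙-inj {bs = []}         {_ ∷ _ ∷ _}   ()
scanl-injective _∙_ ∙-inj {bs = _ ∷ []}     {[]}          ()
scanl-injective _∙_ ∙-inj {bs = _ ∷ _ ∷ _}  {[]}          ()
scanl-injective _∙_ ∙-inj {a} {bs = b ∷ bs} {b′ ∷ bs′} eq with ∷-injective eq
... | refl , eq′ with scanl-injective _∙_ ∙-inj {bs = bs} {bs′} eq′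
...   | ab≡ab′ , refl = refl , cong (_∷ bs) (∙-inj a ab≡ab′)

length-cartesianProductWith : ∀ {B C : Set} (g : A → B → C) xs ys →
  length (cartesianProductWith g xs ys) ≡ length xs * length ys
length-cartesianProductWith g []       ys = refl
length-cartesianProductWith g (x ∷ xs) ys = begin
  length (map (g x) ys ++ cartesianProductWith g xs ys)         ≡⟨ length-++ (map (g x) ys) ⟩
  length (map (g x) ys) + length (cartesianProductWith g xs ys) ≡⟨ cong₂ _+_ (length-map (g x) ys)
                                                                         (length-cartesianProductWith g xs ys) ⟩
  length ys + length xs * length ys                             ∎

allPairs-mapWithAll : ∀ {P : A → Set} {R S : A → A → Set} → (∀ {x y} → P x → P y → R x y → S x y) →
  ∀ {xs} → All P xs → AllPairs R xs → AllPairs S xs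
allPairs-mapWithAll R⇒S []         []         = []
allPairs-mapWithAll R⇒S (px ∷ pxs) (rx ∷ rxs) =
  All.zipWith (λ (py , r) → R⇒S px py r) (pxs , rx) ∷ allPairs-mapWithAll R⇒S pxs rxs

unique-map : ∀ {B : Set} {P : A → Set} (g : A → B) → (∀ {x y} → P x → P y → g x ≡ g y → x ≡ y) →
  ∀ {xs} → All P xs → Unique xs → Unique (map g xs)
unique-map g inj pxs = AllPairs.map⁺ ∘ allPairs-mapWithAll (λ px py x≢y gx≡gy → x≢y (inj px py gx≡gy)) pxs

window : (ℕ → A) → ℕ → ℕ → List A
window x i zero    = []
window x i (suc n) = x i ∷ window x (suc i) n

length-window : ∀ (x : ℕ → A) i n → length (window x i n) ≡ n
length-window x i zero    = refl
length-window x i (suc n) = cong suc (length-window x (suc i) n)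

map-applyUpTo : ∀ {B : Set} (g : A → B) (y : ℕ → A) n → map g (applyUpTo y n) ≡ applyUpTo (g ∘ y) n
map-applyUpTo g y zero    = refl
map-applyUpTo g y (suc n) = cong (g (y 0) ∷_) (map-applyUpTo g (y ∘ suc) n)

applyUpTo-window : ∀ (x y : ℕ → A) i n → (∀ j → y j ≡ x (i + j)) → applyUpTo y n ≡ window x i n
applyUpTo-window x y i zero    _  = refl
applyUpTo-window x y i (suc n) eq =
  cong₂ _∷_ (trans (eq 0) (cong x (+-identityʳ i)))
            (applyUpTo-window x (y ∘ suc) (suc i) n (λ j → trans (eq (suc j)) (cong x (+-suc i j))))

factorAt≡window : ∀ x i n → factorAt x i n ≡ window x i n
factorAt≡window x i n = trans (map-applyUpTo (λ j → x (i + j)) (λ j → j) n) (applyUpTo-window x _ i n (λ _ → refl))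

window-lookup : ∀ (x y : ℕ → A) i j n → window x i n ≡ window y j n → ∀ {k} → k < n → x (i + k) ≡ y (j + k)
window-lookup x y i j (suc n) eq {zero} _ =
  trans (cong x (+-identityʳ i)) (trans (proj₁ (∷-injective eq)) (cong y (sym (+-identityʳ j))))
window-lookup x y i j (suc n) eq {suc k} (s≤s k<n) =
  trans (cong x (+-suc i k))
        (trans (window-lookup x y (suc i) (suc j) n (proj₂ (∷-injective eq)) k<n) (cong y (sym (+-suc j k))))

window-periodic : ∀ (x : ℕ → A) D i n → (∀ {m} → m < i + n → x (D + m) ≡ x m) → window x (D + i) n ≡ window x i n
window-periodic x D i zero    _   = refl
window-periodic x D i (suc n) per =
  cong₂ _∷_ (per (subst (i <_) (sym (+-suc i n)) (s≤s (m≤m+n i n))))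
            (trans (cong (λ j → window x j n) (sym (+-suc D i)))
                   (window-periodic x D (suc i) n (λ {m} m<i+n → per (subst (m <_) (sym (+-suc i n)) m<i+n))))

window-snoc : ∀ (x : ℕ → A) a n → window x a (suc n) ≡ window x a n ++ [ x (a + n) ]
window-snoc x a zero    = cong (λ i → [ x i ]) (sym (+-identityʳ a))
window-snoc x a (suc n) =
  cong (x a ∷_) (trans (window-snoc x (suc a) n) (cong (λ i → window x (suc a) n ++ [ x i ]) (sym (+-suc a n))))

module _ (z x y : ℕ → A) (z-even : ∀ s → z (double s) ≡ x s) (z-odd : ∀ s → z (suc (double s)) ≡ y s) where

  window-even : ∀ t n → window z (double t) n ≡ interleave (window x t ⌈ n /2⌉) (window y t ⌊ n /2⌋)
  window-odd  : ∀ t n → window z (suc (double t)) n ≡ interleave (window y t ⌈ n /2⌉) (window x (suc t) ⌊ n /2⌋)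
  window-even t zero    = refl
  window-even t (suc n) = cong₂ _∷_ (z-even t) (window-odd t n)
  window-odd  t zero    = refl
  window-odd  t (suc n) = cong₂ _∷_ (z-odd t) (window-even (suc t) n)

window-alternatingFrom : ∀ b t n → window (alternatingFrom b) t n ≡ alternating (alternatingFrom b t) n
window-alternatingFrom b t zero    = refl
window-alternatingFrom b t (suc n) = cong ((b xor isOdd t) ∷_) (begin
  window (alternatingFrom b) (suc t) n          ≡⟨ window-alternatingFrom b (suc t) n ⟩
  alternating (b xor not (isOdd t)) n           ≡⟨ cong (λ c → alternating c n) (not-distribʳ-xor b (isOdd t)) ⟨
  alternating (not (b xor isOdd t)) n           ∎)

window-runningSum : ∀ x i n → window (runningSum x) i (suc n) ≡ scanl _xor_ (runningSum x i) (window x i n)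
window-runningSum x i zero    = refl
window-runningSum x i (suc n) = cong (runningSum x i ∷_) (window-runningSum x (suc i) n)

runningSum-+ : ∀ x D i → (∀ {m} → m < i → x (D + m) ≡ x m) → runningSum x (D + i) ≡ runningSum x D xor runningSum x i
runningSum-+ x D zero    _   = trans (cong (runningSum x) (+-identityʳ D)) (sym (xor-identityʳ _))
runningSum-+ x D (suc i) per = begin
  runningSum x (D + suc i)                             ≡⟨ cong (runningSum x) (+-suc D i) ⟩
  runningSum x (D + i) xor x (D + i)                   ≡⟨ cong₂ _xor_ (runningSum-+ x D i (per ∘ m<n⇒m<1+n)) (per ≤-refl) ⟩
  (runningSum x D xor runningSum x i) xor x i          ≡⟨ xor-assoc (runningSum x D) _ _ ⟩
  runningSum x D xor (runningSum x i xor x i)          ∎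

-- Mirrored x a b n: the length-n window of x at b is the reversal of the one at a.
Mirrored : (ℕ → A) → ℕ → ℕ → ℕ → Set
Mirrored x a b n = ∀ k l → suc (k + l) ≡ n → x (b + k) ≡ x (a + l)

mirrored-sym : ∀ (x : ℕ → A) a b {n} → Mirrored x a b n → Mirrored x b a n
mirrored-sym x a b M k l 1+k+l≡n = sym (M l k (trans (cong suc (+-comm l k)) 1+k+l≡n))

window-reverse⇒mirrored : ∀ (x : ℕ → A) a b n → window x b n ≡ reverse (window x a n) → Mirrored x a b n
window-reverse⇒mirrored x a b (suc n) eq k l 1+k+l≡n with ∷-injective (trans eq reverse-window-suc)
  where
  reverse-window-suc : reverse (window x a (suc n)) ≡ x (a + n) ∷ reverse (window x a n)
  reverse-window-suc = trans (cong reverse (window-snoc x a n)) (reverse-++ (window x a n) [ x (a + n) ])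
window-reverse⇒mirrored x a b (suc n) eq zero l refl | xb≡ , _ = trans (cong x (+-identityʳ b)) xb≡
window-reverse⇒mirrored x a b (suc n) eq (suc k) l 1+k+l≡n | _ , eq′ =
  trans (cong x (+-suc b k)) (window-reverse⇒mirrored x a (suc b) n eq′ k l (suc-injective 1+k+l≡n))

mirrored-restrict : ∀ (x : ℕ → A) a b {L} → Mirrored x a b L → ∀ d n e → d + n + e ≡ L → Mirrored x (a + e) (b + d) n
mirrored-restrict x a b {L} M d n e d+n+e≡L k l 1+k+l≡n = begin
  x (b + d + k)   ≡⟨ cong x (+-assoc b d k) ⟩
  x (b + (d + k)) ≡⟨ M (d + k) (e + l) (begin
                       suc (d + k + (e + l)) ≡⟨ trans (cong suc (regroup d k e l)) (sym (+-suc d (k + l + e))) ⟩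
                       d + (suc (k + l) + e) ≡⟨ cong (λ m → d + (m + e)) 1+k+l≡n ⟩
                       d + (n + e)           ≡⟨ +-assoc d n e ⟨
                       d + n + e             ≡⟨ d+n+e≡L ⟩
                       L                     ∎) ⟩
  x (a + (e + l)) ≡⟨ cong x (+-assoc a e l) ⟨
  x (a + e + l)   ∎
  where
  regroup : ∀ d k e l → d + k + (e + l) ≡ d + (k + l + e)
  regroup d k e l = trans (+-assoc d k (e + l)) (cong (d +_) (trans (cong (k +_) (+-comm e l)) (sym (+-assoc k l e))))

runningSum-mirrored : ∀ x i j {L} → Mirrored (runningSum x) i j (suc L) → Mirrored x i j L
runningSum-mirrored x i j M k l 1+k+l≡L = begin
  x (j + k)                                           ≡⟨ difference (j + k) ⟩
  runningSum x (j + k) xor runningSum x (suc (j + k)) ≡⟨ cong₂ _xor_ left right ⟩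
  runningSum x (i + suc l) xor runningSum x (i + l)   ≡⟨ xor-comm (runningSum x (i + suc l)) _ ⟩
  runningSum x (i + l) xor runningSum x (i + suc l)   ≡⟨ cong (λ m → runningSum x (i + l) xor runningSum x m) (+-suc i l) ⟩
  runningSum x (i + l) xor runningSum x (suc (i + l)) ≡⟨ difference (i + l) ⟨
  x (i + l)                                           ∎
  where
  difference : ∀ m → x m ≡ runningSum x m xor runningSum x (suc m)
  difference m = sym (trans (sym (xor-assoc (runningSum x m) (runningSum x m) (x m)))
                            (cong (_xor x m) (xor-same (runningSum x m))))
  left : runningSum x (j + k) ≡ runningSum x (i + suc l)
  left = M k (suc l) (cong suc (trans (+-suc k l) 1+k+l≡L))
  right : runningSum x (suc (j + k)) ≡ runningSum x (i + l)
  right = trans (cong (runningSum x) (sym (+-suc j k))) (M (suc k) l (cong suc 1+k+l≡L))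

-- The paperfolding sequence

length-pfold : ∀ f k → suc (length (pfold f k)) ≡ 2 ^ k
length-pfold f zero    = refl
length-pfold f (suc k) = begin
  suc (length (P ++ f k ∷ E (reverse P)))  ≡⟨ cong suc (length-++ P) ⟩
  suc (length P + suc (length (E (reverse P))))
    ≡⟨ cong (λ n → suc (length P + suc n)) (trans (length-map not (reverse P)) (length-reverse P)) ⟩
  suc (length P) + suc (length P)          ≡⟨ cong (λ n → n + n) (length-pfold f k) ⟩
  2 ^ k + 2 ^ k                            ≡⟨ cong (2 ^ k +_) (+-identityʳ (2 ^ k)) ⟨
  2 ^ suc k                                ∎
  where
  P : Word
  P = pfold f k

length-pfold-mono : ∀ f {k k′} → k ≤ k′ → length (pfold f k) ≤ length (pfold f k′)
length-pfold-mono f {k} {k′} k≤k′ =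
  s≤s⁻¹ (subst₂ _≤_ (sym (length-pfold f k)) (sym (length-pfold f k′)) (^-monoʳ-≤ 2 k≤k′))

length-alternating-pfold : ∀ b f k → length (alternating b (2 ^ k)) ≡ suc (length (pfold f k))
length-alternating-pfold b f k = trans (length-alternating b (2 ^ k)) (sym (length-pfold f k))

pfold-interleave : ∀ f k → pfold f (suc k) ≡ interleave (alternating (f 0) (2 ^ k)) (pfold (shift f) k)
pfold-interleave f zero    = refl
pfold-interleave f (suc k) = begin
  P ++ f (suc k) ∷ E (reverse P)
    ≡⟨ cong (λ R → R ++ f (suc k) ∷ E (reverse R)) (pfold-interleave f k) ⟩
  interleave Alt Q ++ f (suc k) ∷ E (reverse (interleave Alt Q))
    ≡⟨ cong (λ R → interleave Alt Q ++ f (suc k) ∷ E R) (reverse-interleaveˡ Alt Q lengths) ⟩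
  interleave Alt Q ++ f (suc k) ∷ E (interleave (reverse Alt) (reverse Q))
    ≡⟨ cong (λ R → interleave Alt Q ++ f (suc k) ∷ R) (map-interleave not (reverse Alt) (reverse Q)) ⟩
  interleave Alt Q ++ interleave (f (suc k) ∷ E (reverse Q)) (E (reverse Alt))
    ≡⟨ interleave-++ˡ Alt Q (f (suc k) ∷ E (reverse Q)) (E (reverse Alt)) lengths ⟩
  interleave (Alt ++ E (reverse Alt)) (Q ++ f (suc k) ∷ E (reverse Q))
    ≡⟨ cong (λ R → interleave R (pfold (shift f) (suc k))) alternating-doubles ⟩
  interleave (alternating (f 0) (2 ^ suc k)) (pfold (shift f) (suc k)) ∎
  where
  P : Word
  P = pfold f (suc k)
  Alt : Word
  Alt = alternating (f 0) (2 ^ k)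
  Q : Word
  Q = pfold (shift f) k
  lengths : length Alt ≡ suc (length Q)
  lengths = length-alternating-pfold (f 0) (shift f) k
  alternating-doubles : Alt ++ E (reverse Alt) ≡ alternating (f 0) (2 ^ suc k)
  alternating-doubles = begin
    Alt ++ E (reverse Alt)                              ≡⟨ cong (Alt ++_) (E-reverse-alternating (f 0) (2 ^ k)) ⟩
    Alt ++ alternating (f 0 xor isOdd (2 ^ k)) (2 ^ k) ≡⟨ alternating-++ (f 0) (2 ^ k) (2 ^ k) ⟩
    alternating (f 0) (2 ^ k + 2 ^ k)               ≡⟨ cong (λ n → alternating (f 0) (2 ^ k + n)) (+-identityʳ (2 ^ k)) ⟨
    alternating (f 0) (2 ^ suc k)                   ∎

nth-pfold-+ : ∀ f j k {m} → m < length (pfold f k) → nth (pfold f (j + k)) m ≡ nth (pfold f k) m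
nth-pfold-+ f zero    k m<n = refl
nth-pfold-+ f (suc j) k m<n =
  trans (nth-++ˡ (pfold f (j + k)) _ (≤-trans m<n (length-pfold-mono f (m≤n+m k j))))
        (nth-pfold-+ f j k m<n)

<-length-pfold : ∀ f {m k} → m < k → m < length (pfold f k)
<-length-pfold f {m} {k} m<k = s≤s⁻¹ (subst (suc m <_) (sym (length-pfold f k)) (<-≤-trans (s≤s m<k) (n<2^n k)))

paperfolding-nth : ∀ f k {m} → m < length (pfold f k) → paperfolding f m ≡ nth (pfold f k) m
paperfolding-nth f k {m} m<n = begin
  nth (pfold f (suc m)) m     ≡⟨ nth-pfold-+ f k (suc m) (<-length-pfold f (n<1+n m)) ⟨
  nth (pfold f (k + suc m)) m ≡⟨ cong (λ j → nth (pfold f j) m) (+-comm k (suc m)) ⟩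
  nth (pfold f (suc m + k)) m ≡⟨ nth-pfold-+ f (suc m) k m<n ⟩
  nth (pfold f k) m           ∎

pfold-cong : ∀ {f f′} → f ≗ f′ → ∀ k → pfold f k ≡ pfold f′ k
pfold-cong f≗f′ zero    = refl
pfold-cong f≗f′ (suc k) = cong₂ (λ P b → P ++ b ∷ E (reverse P)) (pfold-cong f≗f′ k) (f≗f′ k)

paperfolding-even : ∀ f t → paperfolding f (double t) ≡ alternatingFrom (f 0) t
paperfolding-even f t = begin
  nth (pfold f (suc k)) (double t)              ≡⟨ cong (λ w → nth w (double t)) (pfold-interleave f k) ⟩
  nth (interleave Alt (pfold (shift f) k)) (double t)
    ≡⟨ nth-interleave-even Alt _ (subst (t <_) (sym (length-alternating (f 0) _)) t<2^k)
                                 (≤-reflexive (length-alternating-pfold (f 0) (shift f) k)) ⟩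
  nth Alt t                                     ≡⟨ nth-alternating (f 0) t<2^k ⟩
  f 0 xor isOdd t                               ∎
  where
  k : ℕ
  k = double t
  Alt : Word
  Alt = alternating (f 0) (2 ^ k)
  t<2^k : t < 2 ^ k
  t<2^k = <-≤-trans (n<2^n t) (^-monoʳ-≤ 2 (n≤double t))

paperfolding-odd : ∀ f t → paperfolding f (suc (double t)) ≡ paperfolding (shift f) t
paperfolding-odd f t = begin
  nth (pfold f (suc k)) (suc (double t))        ≡⟨ cong (λ w → nth w (suc (double t))) (pfold-interleave f k) ⟩
  nth (interleave Alt Q) (suc (double t))
    ≡⟨ nth-interleave-odd Alt Q t<n (≤-trans (n≤1+n _) (≤-reflexive (sym (length-alternating-pfold (f 0) (shift f) k)))) ⟩
  nth Q t                                       ≡⟨ paperfolding-nth (shift f) k t<n ⟨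
  paperfolding (shift f) t                      ∎
  where
  k : ℕ
  k = suc (double t)
  Alt : Word
  Alt = alternating (f 0) (2 ^ k)
  Q : Word
  Q = pfold (shift f) k
  t<n : t < length Q
  t<n = <-length-pfold (shift f) (s≤s (n≤double t))

paperfolding-even-+ : ∀ f t r → paperfolding f (double t + double r) ≡ alternatingFrom (f 0) (r + t)
paperfolding-even-+ f t r =
  trans (cong (paperfolding f) (trans (sym (double-+ t r)) (cong double (+-comm t r)))) (paperfolding-even f (r + t))

paperfolding-odd-+ : ∀ f s r → paperfolding f (suc (double s) + double r) ≡ paperfolding (shift f) (r + s)
paperfolding-odd-+ f s r =
  trans (cong (paperfolding f ∘ suc) (trans (sym (double-+ s r)) (cong double (+-comm s r)))) (paperfolding-odd f (r + s))

paperfolding-window-even : ∀ f t n → window (paperfolding f) (double t) n ≡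
  interleave (alternating (alternatingFrom (f 0) t) ⌈ n /2⌉) (window (paperfolding (shift f)) t ⌊ n /2⌋)
paperfolding-window-even f t n =
  trans (window-even (paperfolding f) _ _ (paperfolding-even f) (paperfolding-odd f) t n)
        (cong (λ w → interleave w (window (paperfolding (shift f)) t ⌊ n /2⌋)) (window-alternatingFrom (f 0) t ⌈ n /2⌉))

paperfolding-window-odd : ∀ f t n → window (paperfolding f) (suc (double t)) n ≡
  interleave (window (paperfolding (shift f)) t ⌈ n /2⌉) (alternating (alternatingFrom (f 0) (suc t)) ⌊ n /2⌋)
paperfolding-window-odd f t n =
  trans (window-odd (paperfolding f) _ _ (paperfolding-even f) (paperfolding-odd f) t n)
        (cong (interleave _) (window-alternatingFrom (f 0) (suc t) ⌊ n /2⌋))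

-- For m < 2^J − 1 the letter p(m) is fixed by m mod 2^(v+1) with v < J the 2-adic valuation of m + 1.
paperfolding-periodic : ∀ J f q m → suc m < 2 ^ J → paperfolding f (double (2 ^ J * q) + m) ≡ paperfolding f m
paperfolding-periodic J f q m m<2^J with evenOdd m
paperfolding-periodic zero    f q _ (s≤s ()) | even t
paperfolding-periodic zero    f q _ (s≤s ()) | odd t
paperfolding-periodic (suc J) f q _ _        | even t = begin
  paperfolding f (double D + double t)   ≡⟨ cong (paperfolding f) (double-+ D t) ⟨
  paperfolding f (double (D + t))        ≡⟨ paperfolding-even f (D + t) ⟩
  f 0 xor isOdd (D + t)                  ≡⟨ cong (λ d → f 0 xor isOdd (d + t)) (2^suc*≡double J q) ⟩
  f 0 xor isOdd (double (2 ^ J * q) + t) ≡⟨ cong (f 0 xor_) (isOdd-double-+ (2 ^ J * q) t) ⟩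
  f 0 xor isOdd t                        ≡⟨ paperfolding-even f t ⟨
  paperfolding f (double t)              ∎
  where
  D : ℕ
  D = 2 ^ suc J * q
paperfolding-periodic (suc J) f q _ 2t+1<2^J | odd t = begin
  paperfolding f (double D + suc (double t))      ≡⟨ cong (paperfolding f) (+-suc (double D) (double t)) ⟩
  paperfolding f (suc (double D + double t))      ≡⟨ cong (paperfolding f ∘ suc) (double-+ D t) ⟨
  paperfolding f (suc (double (D + t)))           ≡⟨ paperfolding-odd f (D + t) ⟩
  paperfolding (shift f) (D + t)                  ≡⟨ cong (λ d → paperfolding (shift f) (d + t)) (2^suc*≡double J q) ⟩
  paperfolding (shift f) (double (2 ^ J * q) + t) ≡⟨ paperfolding-periodic J (shift f) q t t<2^J ⟩
  paperfolding (shift f) t                        ≡⟨ paperfolding-odd f t ⟨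
  paperfolding f (suc (double t))                 ∎
  where
  D : ℕ
  D = 2 ^ suc J * q
  2^suc≡double : 2 ^ suc J ≡ double (2 ^ J)
  2^suc≡double = trans (sym (*-identityʳ (2 ^ suc J))) (trans (2^suc*≡double J 1) (cong double (*-identityʳ (2 ^ J))))
  t<2^J : suc t < 2 ^ J
  t<2^J = double-<-cancel (subst (double (suc t) <_) 2^suc≡double 2t+1<2^J)

paperfolding-no-period-2 : ∀ f m → paperfolding f m ≡ paperfolding f (2 + m) →
  paperfolding f (1 + m) ≢ paperfolding f (3 + m)
paperfolding-no-period-2 f m p₀≡p₂ p₁≡p₃ with evenOdd m
... | even t = alternatingFrom-≢-suc (f 0) t
                 (trans (sym (paperfolding-even f t)) (trans p₀≡p₂ (paperfolding-even f (suc t))))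
... | odd t  = alternatingFrom-≢-suc (f 0) (suc t)
                 (trans (sym (paperfolding-even f (suc t))) (trans p₁≡p₃ (paperfolding-even f (suc (suc t)))))

paperfolding-window-parity : ∀ f t s n → 7 ≤ n →
  window (paperfolding f) (double t) n ≢ window (paperfolding f) (suc (double s)) n
paperfolding-window-parity f t s n 7≤n eq =
  paperfolding-no-period-2 (shift f) s
    (trans (sym (v 0 (m≤n+m 1 6))) (trans (sym (alternatingFrom-double-+ (f 0) 1 t)) (v 2 (m≤n+m 5 2))))
    (trans (sym (v 1 (m≤n+m 3 4))) (trans (sym (alternatingFrom-double-+ (f 0) 1 (1 + t))) (v 3 ≤-refl)))
  where
  v : ∀ r → double r < 7 → alternatingFrom (f 0) (r + t) ≡ paperfolding (shift f) (r + s)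
  v r 2r<7 = begin
    alternatingFrom (f 0) (r + t)              ≡⟨ paperfolding-even-+ f t r ⟨
    paperfolding f (double t + double r)       ≡⟨ window-lookup (paperfolding f) (paperfolding f) _ _ n eq (<-≤-trans 2r<7 7≤n) ⟩
    paperfolding f (suc (double s) + double r) ≡⟨ paperfolding-odd-+ f s r ⟩
    paperfolding (shift f) (r + s)             ∎

paperfolding-window-determines-parity : ∀ f {i j} n → 7 ≤ n →
  window (paperfolding f) i n ≡ window (paperfolding f) j n → isOdd i ≡ isOdd j
paperfolding-window-determines-parity f {i} {j} n 7≤n eq with evenOdd i | evenOdd j
... | even t | even s = trans (isOdd-double t) (sym (isOdd-double s))
... | odd t  | odd s  = cong not (trans (isOdd-double t) (sym (isOdd-double s)))
... | even t | odd s  = contradiction eq (paperfolding-window-parity f t s n 7≤n)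
... | odd t  | even s = contradiction (sym eq) (paperfolding-window-parity f s t n 7≤n)

-- The mirror sends even positions to odd ones, carrying the alternation of p on even positions over to p′.
paperfolding-no-mirror₇-even-odd : ∀ f t s → ¬ Mirrored (paperfolding f) (double t) (suc (double s)) 7
paperfolding-no-mirror₇-even-odd f t s M = paperfolding-no-period-2 (shift f) s
  (trans (v 0 3 refl) (trans (alternatingFrom-double-+ (f 0) 1 (1 + t)) (sym (v 2 1 refl))))
  (trans (v 1 2 refl) (trans (alternatingFrom-double-+ (f 0) 1 t) (sym (v 3 0 refl))))
  where
  v : ∀ r′ r → suc (double r′ + double r) ≡ 7 → paperfolding (shift f) (r′ + s) ≡ alternatingFrom (f 0) (r + t)
  v r′ r h = trans (sym (paperfolding-odd-+ f s r′)) (trans (M (double r′) (double r) h) (paperfolding-even-+ f t r))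

paperfolding-no-odd-mirror₇ : ∀ f a b → isOdd (a + b) ≡ true → ¬ Mirrored (paperfolding f) a b 7
paperfolding-no-odd-mirror₇ f a b a+b-odd M with evenOdd a | evenOdd b
... | even t | even s = contradiction (trans (sym (trans (isOdd-double-+ t (double s)) (isOdd-double s))) a+b-odd) λ ()
... | odd t  | odd s  = contradiction (trans (sym (trans (cong not (isOdd-double-+ t (suc (double s))))
                                                          (trans (not-involutive _) (isOdd-double s)))) a+b-odd) λ ()
... | even t | odd s  = paperfolding-no-mirror₇-even-odd f t s M
... | odd t  | even s = paperfolding-no-mirror₇-even-odd f s t (mirrored-sym (paperfolding f) (suc (double t)) (double s) M)

paperfolding-no-mirror₁₃ : ∀ f a₀ b → ¬ Mirrored (paperfolding f) (suc (double a₀)) b 13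
paperfolding-no-mirror₁₃ f a₀ b M with evenOdd b
... | even β = paperfolding-no-odd-mirror₇ f (suc (double a₀) + 0) (double β + 6) a+b-odd
                 (mirrored-restrict (paperfolding f) (suc (double a₀)) (double β) M 6 7 0 refl)
  where
  a+b-odd : isOdd (suc (double a₀) + 0 + (double β + 6)) ≡ true
  a+b-odd = trans (isOdd-+ (suc (double a₀) + 0) _) (cong₂ _xor_ (cong not (isOdd-double-+ a₀ 0)) (isOdd-double-+ β 6))
... | odd β = paperfolding-no-odd-mirror₇ (shift f) a₀ β a₀+β-odd M′
  where
  M′ : Mirrored (paperfolding (shift f)) a₀ β 7
  M′ k l 1+k+l≡7 = begin
    paperfolding (shift f) (β + k)                    ≡⟨ cong (paperfolding (shift f)) (+-comm β k) ⟩
    paperfolding (shift f) (k + β)                    ≡⟨ paperfolding-odd-+ f β k ⟨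
    paperfolding f (suc (double β) + double k)        ≡⟨ M (double k) (double l) 1+2k+2l≡13 ⟩
    paperfolding f (suc (double a₀) + double l)       ≡⟨ paperfolding-odd-+ f a₀ l ⟩
    paperfolding (shift f) (l + a₀)                   ≡⟨ cong (paperfolding (shift f)) (+-comm l a₀) ⟩
    paperfolding (shift f) (a₀ + l)                   ∎
    where
    1+2k+2l≡13 : suc (double k + double l) ≡ 13
    1+2k+2l≡13 = trans (cong suc (sym (double-+ k l))) (suc-injective (cong double 1+k+l≡7))
  -- Comparing the letters at offsets 11 and 1 of the two (odd-position) windows pins down the parity of a₀ + β.
  a₀+β-odd : isOdd (a₀ + β) ≡ true
  a₀+β-odd = begin
    isOdd (a₀ + β)               ≡⟨ isOdd-+ a₀ β ⟩
    isOdd a₀ xor isOdd β         ≡⟨ cong (isOdd a₀ xor_) (xor-cancelˡ (f 0) (begin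
      alternatingFrom (f 0) β                   ≡⟨ alternatingFrom-double-+ (f 0) 3 β ⟨
      alternatingFrom (f 0) (6 + β)             ≡⟨ paperfolding-even-+ f β 6 ⟨
      paperfolding f (double β + 12)            ≡⟨ cong (paperfolding f) (+-suc (double β) 11) ⟩
      paperfolding f (suc (double β) + 11)      ≡⟨ M 11 1 refl ⟩
      paperfolding f (suc (double a₀) + 1)      ≡⟨ cong (paperfolding f) (+-suc (double a₀) 1) ⟨
      paperfolding f (double a₀ + 2)            ≡⟨ paperfolding-even-+ f a₀ 1 ⟩
      alternatingFrom (f 0) (1 + a₀)            ∎)) ⟩
    isOdd a₀ xor not (isOdd a₀)  ≡⟨ xor-inverseʳ (isOdd a₀) ⟩
    true                         ∎

paperfolding-no-mirror : ∀ f a b L → 14 ≤ L → ¬ Mirrored (paperfolding f) a b L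
paperfolding-no-mirror f a b L 14≤L = from-parity (evenOdd a)
  where
  r : ℕ
  r = L ∸ 14
  r+14≡L : r + 14 ≡ L
  r+14≡L = trans (+-comm r 14) (m+[n∸m]≡n 14≤L)
  1+r+13≡L : suc r + 13 + 0 ≡ L
  1+r+13≡L = trans (+-identityʳ (suc r + 13)) (trans (sym (+-suc r 13)) r+14≡L)
  from-parity : ∀ {a} → EvenOdd a → ¬ Mirrored (paperfolding f) a b L
  from-parity (even a₀) M = paperfolding-no-mirror₁₃ f a₀ (b + r)
    (subst (λ a′ → Mirrored (paperfolding f) a′ (b + r) 13) (+-comm (double a₀) 1)
           (mirrored-restrict (paperfolding f) (double a₀) b M r 13 1 (trans (+-assoc r 13 1) r+14≡L)))
  from-parity (odd a₀)  M = paperfolding-no-mirror₁₃ f a₀ (b + suc r)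
    (subst (λ a′ → Mirrored (paperfolding f) a′ (b + suc r) 13) (+-identityʳ (suc (double a₀)))
           (mirrored-restrict (paperfolding f) (suc (double a₀)) b M (suc r) 13 0 1+r+13≡L))

-- Factors of the paperfolding sequence

OccursAtParity : (ℕ → Bool) → ℕ → Word × Bool → Set
OccursAtParity f n (w , e) = ∃ λ i → isOdd i ≡ e × window (paperfolding f) i n ≡ w

letter-occurs-even : ∀ f b → OccursAtParity f 1 ([ b ] , false)
letter-occurs-even f b with f 0 ≟ b
... | yes f₀≡b = 0 , refl , cong [_] (trans (paperfolding-even f 0) (trans (xor-identityʳ (f 0)) f₀≡b))
... | no  f₀≢b =
  2 , refl , cong [_] (trans (paperfolding-even f 1) (trans (xor-comm (f 0) true) (sym (¬-not (f₀≢b ∘ sym)))))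

letter-occurs : ∀ f b e → OccursAtParity f 1 ([ b ] , e)
letter-occurs f b false = letter-occurs-even f b
letter-occurs f b true with letter-occurs-even (shift f) b
... | t , _ , pt = suc (double t) , cong not (isOdd-double t) , trans (cong [_] (paperfolding-odd f t)) pt

atEven atOdd : Bool → ℕ → Word × Bool → Word × Bool
atEven b n (u , e) = interleave (alternating (b xor e) ⌈ n /2⌉) u , false
atOdd  b n (u , e) = interleave u (alternating (b xor not e) ⌊ n /2⌋) , true

letters : List (Word × Bool)
letters = ([ false ] , false) ∷ ([ true ] , false) ∷ ([ false ] , true) ∷ ([ true ] , true) ∷ []

-- The first argument is fuel: the recursion halves n, so n ≤ fuel suffices.
parityFactorsWithin : ℕ → (ℕ → Bool) → ℕ → List (Word × Bool)
parityFactorsWithin _       f zero          = ([] , false) ∷ ([] , true) ∷ []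
parityFactorsWithin zero    f (suc _)       = []
parityFactorsWithin (suc k) f 1             = letters
parityFactorsWithin (suc k) f n@(suc (suc _)) =
  map (atEven (f 0) n) (parityFactorsWithin k (shift f) ⌊ n /2⌋) ++
  map (atOdd  (f 0) n) (parityFactorsWithin k (shift f) ⌈ n /2⌉)

parityFactors : (ℕ → Bool) → ℕ → List (Word × Bool)
parityFactors f n = parityFactorsWithin n f n

atEven-occurs : ∀ f n {x} → OccursAtParity (shift f) ⌊ n /2⌋ x → OccursAtParity f n (atEven (f 0) n x)
atEven-occurs f n (t , refl , refl) = double t , isOdd-double t , paperfolding-window-even f t n

atOdd-occurs : ∀ f n {x} → OccursAtParity (shift f) ⌈ n /2⌉ x → OccursAtParity f n (atOdd (f 0) n x)
atOdd-occurs f n (t , refl , refl) = suc (double t) , cong not (isOdd-double t) , paperfolding-window-odd f t n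

parityFactorsWithin-sound : ∀ k f n → All (OccursAtParity f n) (parityFactorsWithin k f n)
parityFactorsWithin-sound _       f zero    = (0 , refl , refl) ∷ (1 , refl , refl) ∷ []
parityFactorsWithin-sound zero    f (suc _) = []
parityFactorsWithin-sound (suc k) f 1       =
  letter-occurs f false false ∷ letter-occurs f true false ∷ letter-occurs f false true ∷ letter-occurs f true true ∷ []
parityFactorsWithin-sound (suc k) f n@(suc (suc _)) =
  All.++⁺ (All.map⁺ (All.map (atEven-occurs f n) (parityFactorsWithin-sound k (shift f) ⌊ n /2⌋)))
          (All.map⁺ (All.map (atOdd-occurs f n) (parityFactorsWithin-sound k (shift f) ⌈ n /2⌉)))

parityFactorsWithin-complete : ∀ k f n → n ≤ k → ∀ i →
  (window (paperfolding f) i n , isOdd i) ∈ parityFactorsWithin k f n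
parityFactorsWithin-complete k f zero _ i = empty∈ (isOdd i)
  where
  empty∈ : ∀ e → ([] , e) ∈ parityFactorsWithin k f zero
  empty∈ false = here refl
  empty∈ true  = there (here refl)
parityFactorsWithin-complete (suc k) f 1 _ i = letter∈ (paperfolding f i) (isOdd i)
  where
  letter∈ : ∀ b e → ([ b ] , e) ∈ letters
  letter∈ false false = here refl
  letter∈ true  false = there (here refl)
  letter∈ false true  = there (there (here refl))
  letter∈ true  true  = there (there (there (here refl)))
parityFactorsWithin-complete (suc k) f n@(suc (suc m)) (s≤s n≤k) i with evenOdd i
... | even t = subst (_∈ parityFactorsWithin (suc k) f n)
                     (sym (cong₂ _,_ (paperfolding-window-even f t n) (isOdd-double t)))
                     (∈-++⁺ˡ (∈-map⁺ (atEven (f 0) n)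
                       (parityFactorsWithin-complete k (shift f) ⌊ n /2⌋ (≤-trans (s≤s (⌊n/2⌋≤n m)) n≤k) t)))
... | odd t  = subst (_∈ parityFactorsWithin (suc k) f n)
                     (sym (cong₂ _,_ (paperfolding-window-odd f t n) (cong not (isOdd-double t))))
                     (∈-++⁺ʳ _ (∈-map⁺ (atOdd (f 0) n)
                       (parityFactorsWithin-complete k (shift f) ⌈ n /2⌉ (≤-trans (s≤s (⌈n/2⌉≤n m)) n≤k) t)))

length-parityFactorsWithin : ∀ k f n → n ≤ k → 1 ≤ n → length (parityFactorsWithin k f n) ≡ 4 * n
length-parityFactorsWithin (suc k) f 1 _ _ = refl
length-parityFactorsWithin (suc k) f n@(suc (suc m)) (s≤s n≤k) _ = begin
  length (map (atEven (f 0) n) Fs ++ map (atOdd (f 0) n) Fs′)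
    ≡⟨ length-++ (map (atEven (f 0) n) Fs) ⟩
  length (map (atEven (f 0) n) Fs) + length (map (atOdd (f 0) n) Fs′)
    ≡⟨ cong₂ _+_ (length-map (atEven (f 0) n) Fs) (length-map (atOdd (f 0) n) Fs′) ⟩
  length Fs + length Fs′
    ≡⟨ cong₂ _+_ (length-parityFactorsWithin k (shift f) ⌊ n /2⌋ (≤-trans (s≤s (⌊n/2⌋≤n m)) n≤k) (s≤s z≤n))
                 (length-parityFactorsWithin k (shift f) ⌈ n /2⌉ (≤-trans (s≤s (⌈n/2⌉≤n m)) n≤k) (s≤s z≤n)) ⟩
  4 * ⌊ n /2⌋ + 4 * ⌈ n /2⌉ ≡⟨ *-distribˡ-+ 4 ⌊ n /2⌋ ⌈ n /2⌉ ⟨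
  4 * (⌊ n /2⌋ + ⌈ n /2⌉)   ≡⟨ cong (4 *_) (⌊n/2⌋+⌈n/2⌉≡n n) ⟩
  4 * n                     ∎
  where
  Fs : List (Word × Bool)
  Fs = parityFactorsWithin k (shift f) ⌊ n /2⌋
  Fs′ : List (Word × Bool)
  Fs′ = parityFactorsWithin k (shift f) ⌈ n /2⌉

atEven-injective : ∀ b n {x y} → length (proj₁ x) ≡ length (proj₁ y) →
  atEven b (2 + n) x ≡ atEven b (2 + n) y → x ≡ y
atEven-injective b n {u , e} {v , e′} lu eq
  with interleave-injective (alternating (b xor e) ⌈ 2 + n /2⌉) (alternating (b xor e′) ⌈ 2 + n /2⌉) u v
         (length-alternating-indep (b xor e) (b xor e′) ⌈ 2 + n /2⌉) lu (cong proj₁ eq)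
... | alt≡ , refl = cong (u ,_) (xor-cancelˡ b (proj₁ (∷-injective alt≡)))

atOdd-injective : ∀ b n {x y} → length (proj₁ x) ≡ length (proj₁ y) →
  atOdd b (2 + n) x ≡ atOdd b (2 + n) y → x ≡ y
atOdd-injective b n {u , e} {v , e′} lu eq
  with interleave-injective u v (alternating (b xor not e) ⌊ 2 + n /2⌋) (alternating (b xor not e′) ⌊ 2 + n /2⌋)
         lu (length-alternating-indep (b xor not e) (b xor not e′) ⌊ 2 + n /2⌋) (cong proj₁ eq)
... | refl , alt≡ = cong (u ,_) (not-injective (xor-cancelˡ b (proj₁ (∷-injective alt≡))))

occurs⇒length : ∀ f n {x} → OccursAtParity f n x → length (proj₁ x) ≡ n
occurs⇒length f n (i , _ , refl) = length-window (paperfolding f) i n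

parityFactorsWithin-unique : ∀ k f n → Unique (parityFactorsWithin k f n)
parityFactorsWithin-unique _       f zero    = ((λ ()) ∷ []) ∷ [] ∷ []
parityFactorsWithin-unique zero    f (suc _) = []
parityFactorsWithin-unique (suc k) f 1       =
  ((λ ()) ∷ (λ ()) ∷ (λ ()) ∷ []) ∷ ((λ ()) ∷ (λ ()) ∷ []) ∷ ((λ ()) ∷ []) ∷ [] ∷ []
parityFactorsWithin-unique (suc k) f n@(suc (suc m)) =
  Unique.++⁺ (unique-map (atEven (f 0) n) (sameLength (atEven-injective (f 0) m))
                         (parityFactorsWithin-sound k (shift f) ⌊ n /2⌋) (parityFactorsWithin-unique k (shift f) ⌊ n /2⌋))
             (unique-map (atOdd (f 0) n) (sameLength (atOdd-injective (f 0) m))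
                         (parityFactorsWithin-sound k (shift f) ⌈ n /2⌉) (parityFactorsWithin-unique k (shift f) ⌈ n /2⌉))
             tags-differ
  where
  sameLength : ∀ {g : Word × Bool → Word × Bool} {ℓ} →
    (∀ {x y} → length (proj₁ x) ≡ length (proj₁ y) → g x ≡ g y → x ≡ y) →
    ∀ {x y} → OccursAtParity (shift f) ℓ x → OccursAtParity (shift f) ℓ y → g x ≡ g y → x ≡ y
  sameLength inj ox oy = inj (trans (occurs⇒length (shift f) _ ox) (sym (occurs⇒length (shift f) _ oy)))
  tags-differ : ∀ {v} → ¬ (v ∈ map (atEven (f 0) n) (parityFactorsWithin k (shift f) ⌊ n /2⌋)
                         × v ∈ map (atOdd (f 0) n) (parityFactorsWithin k (shift f) ⌈ n /2⌉))
  tags-differ (v∈E , v∈O) with ∈-map⁻ (atEven (f 0) n) v∈E | ∈-map⁻ (atOdd (f 0) n) v∈O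
  ... | _ , _ , refl | _ , _ , ()

parityFactorsWithin-cong : ∀ {f f′} → f ≗ f′ → ∀ k n → parityFactorsWithin k f n ≡ parityFactorsWithin k f′ n
parityFactorsWithin-cong f≗f′ _       zero    = refl
parityFactorsWithin-cong f≗f′ zero    (suc _) = refl
parityFactorsWithin-cong f≗f′ (suc k) 1       = refl
parityFactorsWithin-cong f≗f′ (suc k) n@(suc (suc _)) =
  cong₂ _++_ (cong₂ (λ b F → map (atEven b n) F) (f≗f′ 0) (parityFactorsWithin-cong (f≗f′ ∘ suc) k ⌊ n /2⌋))
             (cong₂ (λ b F → map (atOdd b n) F) (f≗f′ 0) (parityFactorsWithin-cong (f≗f′ ∘ suc) k ⌈ n /2⌉))

paperfoldingFactors : (ℕ → Bool) → ℕ → List Word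
paperfoldingFactors f n = map proj₁ (parityFactors f n)

paperfoldingFactors-unique : ∀ f n → 7 ≤ n → Unique (paperfoldingFactors f n)
paperfoldingFactors-unique f n 7≤n =
  unique-map proj₁ parity-determined (parityFactorsWithin-sound n f n) (parityFactorsWithin-unique n f n)
  where
  parity-determined : ∀ {x y} → OccursAtParity f n x → OccursAtParity f n y → proj₁ x ≡ proj₁ y → x ≡ y
  parity-determined (i , refl , refl) (j , refl , refl) eq =
    cong₂ _,_ eq (paperfolding-window-determines-parity f n 7≤n eq)

-- The Golay–Shapiro sequence

golayShapiro-double : ∀ f t → golayShapiro f (double t) ≡ golayShapiro (shift f) t xor runningSum (alternatingFrom (f 0)) t
golayShapiro-double f zero    = refl
golayShapiro-double f (suc t) = begin
  (golayShapiro f (double t) xor paperfolding f (double t)) xor paperfolding f (suc (double t))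
    ≡⟨ cong₂ (λ a b → (a xor b) xor paperfolding f (suc (double t))) (golayShapiro-double f t) (paperfolding-even f t) ⟩
  ((g′ xor r) xor alternatingFrom (f 0) t) xor paperfolding f (suc (double t))
    ≡⟨ cong (((g′ xor r) xor alternatingFrom (f 0) t) xor_) (paperfolding-odd f t) ⟩
  ((g′ xor r) xor alternatingFrom (f 0) t) xor paperfolding (shift f) t
    ≡⟨ xor-interchange g′ r _ _ ⟩
  (g′ xor paperfolding (shift f) t) xor (r xor alternatingFrom (f 0) t) ∎
  where
  g′ : Bool
  g′ = golayShapiro (shift f) t
  r : Bool
  r = runningSum (alternatingFrom (f 0)) t

runningSum-alternatingFrom-+2 : ∀ b N → runningSum (alternatingFrom b) (2 + N) ≡ not (runningSum (alternatingFrom b) N)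
runningSum-alternatingFrom-+2 b N = begin
  (r xor (b xor isOdd N)) xor (b xor not (isOdd N)) ≡⟨ xor-assoc r _ _ ⟩
  r xor ((b xor isOdd N) xor (b xor not (isOdd N))) ≡⟨ cong (λ c → r xor ((b xor isOdd N) xor c)) (not-distribʳ-xor b (isOdd N)) ⟨
  r xor ((b xor isOdd N) xor not (b xor isOdd N))   ≡⟨ cong (r xor_) (xor-inverseʳ (b xor isOdd N)) ⟩
  r xor true                                        ≡⟨ xor-comm r true ⟩
  not r                                             ∎
  where
  r : Bool
  r = runningSum (alternatingFrom b) N

runningSum-alternatingFrom-4* : ∀ b w → runningSum (alternatingFrom b) (double (double w)) ≡ false
runningSum-alternatingFrom-4* b zero    = refl
runningSum-alternatingFrom-4* b (suc w) = begin
  runningSum (alternatingFrom b) (2 + (2 + N))      ≡⟨ runningSum-alternatingFrom-+2 b (2 + N) ⟩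
  not (runningSum (alternatingFrom b) (2 + N))      ≡⟨ cong not (runningSum-alternatingFrom-+2 b N) ⟩
  not (not (runningSum (alternatingFrom b) N))      ≡⟨ not-involutive _ ⟩
  runningSum (alternatingFrom b) N                  ≡⟨ runningSum-alternatingFrom-4* b w ⟩
  false                                             ∎
  where
  N : ℕ
  N = double (double w)

golayShapiro-cong : ∀ {f f′} → f ≗ f′ → golayShapiro f ≗ golayShapiro f′
golayShapiro-cong f≗f′ zero    = refl
golayShapiro-cong f≗f′ (suc m) =
  cong₂ _xor_ (golayShapiro-cong f≗f′ m) (cong (λ P → nth P m) (pfold-cong f≗f′ (suc m)))

pow2Multiple : ℕ → ℕ → ℕ
pow2Multiple J q = double (2 ^ suc J * q)

golayShapiro-pow2Multiple-shift : ∀ f J q →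
  golayShapiro f (pow2Multiple (suc J) q) ≡ golayShapiro (shift f) (pow2Multiple J q)
golayShapiro-pow2Multiple-shift f J q = begin
  golayShapiro f (double (2 ^ suc (suc J) * q))   ≡⟨ cong (golayShapiro f ∘ double) (2^suc*≡double (suc J) q) ⟩
  golayShapiro f (double M)                       ≡⟨ golayShapiro-double f M ⟩
  golayShapiro (shift f) M xor runningSum (alternatingFrom (f 0)) M
    ≡⟨ cong (λ m → golayShapiro (shift f) M xor runningSum (alternatingFrom (f 0)) (double m)) (2^suc*≡double J q) ⟩
  golayShapiro (shift f) M xor runningSum (alternatingFrom (f 0)) (double (double (2 ^ J * q)))
    ≡⟨ cong (golayShapiro (shift f) M xor_) (runningSum-alternatingFrom-4* (f 0) (2 ^ J * q)) ⟩
  golayShapiro (shift f) M xor false              ≡⟨ xor-identityʳ _ ⟩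
  golayShapiro (shift f) M                        ∎
  where
  M : ℕ
  M = pow2Multiple J q

multiplesSum : (ℕ → Bool) → ℕ → Bool
multiplesSum f J =
  (golayShapiro f (pow2Multiple J 1) xor golayShapiro f (pow2Multiple J 2)) xor golayShapiro f (pow2Multiple J 3)

multiplesSum-true : ∀ J f → multiplesSum f J ≡ true
multiplesSum-true zero    f =
  trans (cong₂ _xor_ (cong₂ _xor_ (≡prefix 4) (≡prefix 8)) (≡prefix 12)) (check (f 0) (f 1) (f 2) (f 3))
  where
  ≡prefix : ∀ m → golayShapiro f m ≡ golayShapiro (prefix4 f) m
  ≡prefix = golayShapiro-cong (≗prefix4 f)
  check : ∀ b₀ b₁ b₂ b₃ → multiplesSum (b₀ ∷ˢ b₁ ∷ˢ b₂ ∷ˢ b₃ ∷ˢ λ k → f (4 + k)) 0 ≡ true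
  check = from-yes (all-Bool? λ b₀ → all-Bool? λ b₁ → all-Bool? λ b₂ → all-Bool? λ b₃ →
                      multiplesSum (b₀ ∷ˢ b₁ ∷ˢ b₂ ∷ˢ b₃ ∷ˢ λ k → f (4 + k)) 0 ≟ true)
multiplesSum-true (suc J) f =
  trans (cong₂ _xor_ (cong₂ _xor_ (golayShapiro-pow2Multiple-shift f J 1) (golayShapiro-pow2Multiple-shift f J 2))
                     (golayShapiro-pow2Multiple-shift f J 3))
        (multiplesSum-true J (shift f))

golayShapiro-true-at-pow2Multiple : ∀ J f → ∃ λ q → golayShapiro f (pow2Multiple J q) ≡ true
golayShapiro-true-at-pow2Multiple J f with xor³≡true (multiplesSum-true J f)
... | inj₁ g₁        = 1 , g₁
... | inj₂ (inj₁ g₂) = 2 , g₂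
... | inj₂ (inj₂ g₃) = 3 , g₃

paperfolding-window-reoccurs : ∀ f i n c →
  ∃ λ j → window (paperfolding f) j n ≡ window (paperfolding f) i n × golayShapiro f j ≡ c
paperfolding-window-reoccurs f i n c with golayShapiro f i ≟ c
... | yes gᵢ≡c = i , refl , gᵢ≡c
... | no  gᵢ≢c with golayShapiro-true-at-pow2Multiple (i + n) f
...   | q , g[D]≡true = D + i , window-periodic (paperfolding f) D i n periodic , (begin
  golayShapiro f (D + i)                 ≡⟨ runningSum-+ (paperfolding f) D i (λ m<i → periodic (≤-trans m<i (m≤m+n i n))) ⟩
  golayShapiro f D xor golayShapiro f i  ≡⟨ cong (_xor golayShapiro f i) g[D]≡true ⟩
  not (golayShapiro f i)                 ≡⟨ ¬-not (gᵢ≢c ∘ sym) ⟨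
  c                                      ∎)
  where
  D : ℕ
  D = pow2Multiple (i + n) q
  periodic : ∀ {m} → m < i + n → paperfolding f (D + m) ≡ paperfolding f m
  periodic {m} m<i+n = paperfolding-periodic (suc (i + n)) f q m
    (≤-<-trans m<i+n (<-≤-trans (n<2^n (i + n)) (^-monoʳ-≤ 2 (n≤1+n (i + n)))))

golayShapiroFactors : (ℕ → Bool) → ℕ → List Word
golayShapiroFactors f n = cartesianProductWith (scanl _xor_) (false ∷ true ∷ []) (paperfoldingFactors f n)

golayShapiro-factorAt : ∀ f i n →
  factorAt (golayShapiro f) i (suc n) ≡ scanl _xor_ (golayShapiro f i) (window (paperfolding f) i n)
golayShapiro-factorAt f i n = trans (factorAt≡window (golayShapiro f) i (suc n)) (window-runningSum (paperfolding f) i n)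

golayShapiroFactors-complete : ∀ f n i → factorAt (golayShapiro f) i (suc n) ∈ golayShapiroFactors f n
golayShapiroFactors-complete f n i =
  subst (_∈ golayShapiroFactors f n) (sym (golayShapiro-factorAt f i n))
        (∈-cartesianProductWith⁺ (scanl _xor_) (bool∈ (golayShapiro f i))
          (∈-map⁺ proj₁ (parityFactorsWithin-complete n f n ≤-refl i)))
  where
  bool∈ : ∀ b → b ∈ false ∷ true ∷ []
  bool∈ false = here refl
  bool∈ true  = there (here refl)

golayShapiroFactors-sound : ∀ f n → All (IsFactor (golayShapiro f) (suc n)) (golayShapiroFactors f n)
golayShapiroFactors-sound f n = All.tabulate factor
  where
  factor : ∀ {v} → v ∈ golayShapiroFactors f n → IsFactor (golayShapiro f) (suc n) v
  factor v∈ with ∈-cartesianProductWith⁻ (scanl _xor_) (false ∷ true ∷ []) (paperfoldingFactors f n) v∈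
  ... | c , _ , _ , w∈ , refl with ∈-map⁻ proj₁ w∈
  ...   | _ , x∈ , refl with All.lookup (parityFactorsWithin-sound n f n) x∈
  ...     | i , _ , refl with paperfolding-window-reoccurs f i n c
  ...       | j , wⱼ≡wᵢ , gⱼ≡c = j , trans (golayShapiro-factorAt f j n) (cong₂ (scanl _xor_) gⱼ≡c wⱼ≡wᵢ)

golayShapiroFactors-unique : ∀ f n → 7 ≤ n → Unique (golayShapiroFactors f n)
golayShapiroFactors-unique f n 7≤n =
  Unique.cartesianProductWith⁺ (scanl _xor_) (scanl-injective _xor_ xor-cancelˡ) (((λ ()) ∷ []) ∷ [] ∷ [])
                               (paperfoldingFactors-unique f n 7≤n)

length-golayShapiroFactors : ∀ f n → 1 ≤ n → length (golayShapiroFactors f n) ≡ 8 * n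
length-golayShapiroFactors f n 1≤n = begin
  length (golayShapiroFactors f n)        ≡⟨ length-cartesianProductWith (scanl _xor_) (false ∷ true ∷ []) (paperfoldingFactors f n) ⟩
  2 * length (paperfoldingFactors f n)    ≡⟨ cong (2 *_) (length-map proj₁ (parityFactors f n)) ⟩
  2 * length (parityFactors f n)          ≡⟨ cong (2 *_) (length-parityFactorsWithin n f n ≤-refl 1≤n) ⟩
  2 * (4 * n)                             ≡⟨ *-assoc 2 4 n ⟨
  8 * n                                   ∎

golayShapiro-no-reversed-factors : ∀ f n → 14 ≤ n → ∀ {u v} →
  IsFactor (golayShapiro f) (suc n) u → IsFactor (golayShapiro f) (suc n) v → v ≢ reverse u
golayShapiro-no-reversed-factors f n 14≤n (i , refl) (j , refl) v≡uᴿ =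
  paperfolding-no-mirror f i j n 14≤n
    (runningSum-mirrored (paperfolding f) i j (window-reverse⇒mirrored (golayShapiro f) i j (suc n) (begin
      window (golayShapiro f) j (suc n)             ≡⟨ factorAt≡window (golayShapiro f) j (suc n) ⟨
      factorAt (golayShapiro f) j (suc n)           ≡⟨ v≡uᴿ ⟩
      reverse (factorAt (golayShapiro f) i (suc n)) ≡⟨ cong reverse (factorAt≡window (golayShapiro f) i (suc n)) ⟩
      reverse (window (golayShapiro f) i (suc n))   ∎)))

-- Reflection complexity

∼-trans : ∀ {u v w} → u ∼ v → v ∼ w → u ∼ w
∼-trans (inj₁ refl) v∼w         = v∼w
∼-trans (inj₂ refl) (inj₁ refl) = inj₂ refl
∼-trans {u} (inj₂ refl) (inj₂ refl) = inj₁ (reverse-involutive u)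

_∼?_ : Decidable _∼_
u ∼? v = ≡-dec _≟_ v u ⊎-dec ≡-dec _≟_ v (reverse u)

reversalDecSetoid : DecSetoid _ _
reversalDecSetoid = record
  { Carrier          = Word
  ; _≈_              = _∼_
  ; isDecEquivalence = record
    { isEquivalence = record
      { refl  = inj₁ refl
      ; sym   = λ { (inj₁ refl) → inj₁ refl ; (inj₂ refl) → inj₂ (sym (reverse-involutive _)) }
      ; trans = ∼-trans
      }
    ; _≟_ = _∼?_
    }
  }

reflectionComplexity-deduplicate : ∀ g n L → All (IsFactor g n) L → (∀ i → factorAt g i n ∈ L) →
  ReflectionComplexity g n (length (deduplicate _∼?_ L))
reflectionComplexity-deduplicate g n L factors complete =
  deduplicate _∼?_ L , refl , deduplicate-! reversalDecSetoid L , All.deduplicate⁺ _∼?_ factors ,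
  λ i → Any.deduplicate⁺ _∼?_ (λ v∼u u∼w → ∼-trans v∼u u∼w) (Any.map inj₁ (complete i))

reflectionComplexity-reversalFree : ∀ g n L → Unique L → All (IsFactor g n) L → (∀ i → factorAt g i n ∈ L) →
  (∀ {u v} → IsFactor g n u → IsFactor g n v → v ≢ reverse u) → ReflectionComplexity g n (length L)
reflectionComplexity-reversalFree g n L unique factors complete reversal-free =
  L , refl , allPairs-mapWithAll inequivalent factors unique , factors , λ i → Any.map inj₁ (complete i)
  where
  inequivalent : ∀ {u v} → IsFactor g n u → IsFactor g n v → u ≢ v → ¬ (u ∼ v)
  inequivalent _  _  u≢v (inj₁ v≡u)  = u≢v (sym v≡u)
  inequivalent fu fv _   (inj₂ v≡uᴿ) = reversal-free fu fv v≡uᴿ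

-- For n < 14 the recursion defining these lists reads only f 0, …, f 3, so the count is a finite computation.
golayShapiroFactors-classes : ∀ f n → n < 14 → length (deduplicate _∼?_ (golayShapiroFactors f n)) ≡ rTable (suc n)
golayShapiroFactors-classes f n n<14 = begin
  length (deduplicate _∼?_ (golayShapiroFactors f n))
    ≡⟨ cong (λ F → length (deduplicate _∼?_ (cartesianProductWith (scanl _xor_) (false ∷ true ∷ []) (map proj₁ F))))
            (parityFactorsWithin-cong (≗prefix4 f) n n) ⟩
  length (deduplicate _∼?_ (golayShapiroFactors (prefix4 f) n))
    ≡⟨ All.lookup (check (f 0) (f 1) (f 2) (f 3)) (∈-upTo⁺ n<14) ⟩
  rTable (suc n) ∎
  where
  classes : (ℕ → Bool) → ℕ → ℕ
  classes f′ m = length (deduplicate _∼?_ (golayShapiroFactors f′ m))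
  check : ∀ b₀ b₁ b₂ b₃ → All (λ m → classes (b₀ ∷ˢ b₁ ∷ˢ b₂ ∷ˢ b₃ ∷ˢ λ k → f (4 + k)) m ≡ rTable (suc m)) (upTo 14)
  check = from-yes (all-Bool? λ b₀ → all-Bool? λ b₁ → all-Bool? λ b₂ → all-Bool? λ b₃ →
                      All.all? (λ m → classes (b₀ ∷ˢ b₁ ∷ˢ b₂ ∷ˢ b₃ ∷ˢ λ k → f (4 + k)) m ℕₚ.≟ rTable (suc m)) (upTo 14))

Complexities : (ℕ → Bool) → ℕ → ℕ → Set
Complexities g n k = ReflectionComplexity g n k × FactorComplexity g n k

golayShapiro-complexities : ∀ f n → 14 ≤ n → Complexities (golayShapiro f) (suc n) (8 * n)
golayShapiro-complexities f n 14≤n =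
  subst (Complexities (golayShapiro f) (suc n)) (length-golayShapiroFactors f n (≤-trans (s≤s z≤n) 14≤n))
    ( reflectionComplexity-reversalFree (golayShapiro f) (suc n) (golayShapiroFactors f n) unique sound complete
        (golayShapiro-no-reversed-factors f n 14≤n)
    , (golayShapiroFactors f n , refl , unique , sound , complete))
  where
  unique : Unique (golayShapiroFactors f n)
  unique = golayShapiroFactors-unique f n (≤-trans (m≤n+m 7 7) 14≤n)
  sound : All (IsFactor (golayShapiro f) (suc n)) (golayShapiroFactors f n)
  sound = golayShapiroFactors-sound f n
  complete : ∀ i → factorAt (golayShapiro f) i (suc n) ∈ golayShapiroFactors f n
  complete = golayShapiroFactors-complete f n

golayShapiro-reflectionComplexity-small : ∀ f n → n < 14 → ReflectionComplexity (golayShapiro f) (suc n) (rTable (suc n))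
golayShapiro-reflectionComplexity-small f n n<14 =
  subst (ReflectionComplexity (golayShapiro f) (suc n)) (golayShapiroFactors-classes f n n<14)
    (reflectionComplexity-deduplicate (golayShapiro f) (suc n) (golayShapiroFactors f n)
      (golayShapiroFactors-sound f n) (golayShapiroFactors-complete f n))

8*suc∸8 : ∀ n → 8 * suc n ∸ 8 ≡ 8 * n
8*suc∸8 n = trans (cong (_∸ 8) (*-suc 8 n)) (m+n∸m≡n 8 (8 * n))

theorem8p5 : (f : ℕ → Bool) →
    ((n : ℕ) → 15 ≤ n →
      ReflectionComplexity (golayShapiro f) n (8 * n ∸ 8)
      × FactorComplexity (golayShapiro f) n (8 * n ∸ 8))
    × ((n : ℕ) → 1 ≤ n → n ≤ 14 →
      ReflectionComplexity (golayShapiro f) n (rTable n))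
theorem8p5 f = large , small
  where
  large : (n : ℕ) → 15 ≤ n → Complexities (golayShapiro f) n (8 * n ∸ 8)
  large (suc n) (s≤s 14≤n) =
    subst (Complexities (golayShapiro f) (suc n)) (sym (8*suc∸8 n)) (golayShapiro-complexities f n 14≤n)
  small : (n : ℕ) → 1 ≤ n → n ≤ 14 → ReflectionComplexity (golayShapiro f) n (rTable n)
  small (suc n) _ n<14 = golayShapiro-reflectionComplexity-small f n n<14
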